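{- There exist a nonempty set $W$ and a family $B$ of subsets of $W$ containing $\emptyset$ and $W$ and closed under $\cup$ such that the structure $(B,\subseteq,\emptyset,W,\cup,C)$, where $aCb$ iff $a\cap b\neq\emptyset$, is a contact join-semilattice but not a distributive contact join-semilattice.
   Context: All structures are of the form $(B,\leq,0,1,+,C)$. Axioms (for all elements): (1) $x\leq x$; (2) $x\leq y\wedge y\leq x\rightarrow x=y$; (3) $x\leq y\wedge y\leq z\rightarrow x\leq z$; (4) $x+y=y+x$; (5) $x\leq x+y$; (6) $x\leq z\wedge y\leq z\rightarrow x+y\leq z$; (7) $0\leq x$; (8) $x\leq 1$; (9) $xCy\rightarrow x\neq 0$; (10) $xCy\rightarrow yCx$; (11) $xC(y+z)\rightarrow xCy$ or $xCz$; (12) $xCy\wedge y\leq y'\rightarrow xCy'$; (13) $x\neq 0\rightarrow xCx$; (ad) if $x\leq a+b$ then there are $a'\leq a$, $b'\leq b$ with $x=a'+b'$; and for all integers $m,i,n\geq1$: $A^1_{m,i}$: if $xCy$, and $x\leq s_j^1+\dots+s_j^i$ and $y\leq t_j^1+\dots+t_j^i$ for every $j=1,\dots,m$, then there are $l_1,\dots,l_m,k_1,\dots,k_m\in\{1,\dots,i\}$ with $s_j^{l_j}Cs_u^{l_u}$ and $t_j^{k_j}Ct_u^{k_u}$ for all $1\leq j\leq u\leq m$, and $s_j^{l_j}Ct_u^{k_u}$ for all $j,u$; $A_{n,i}$: if $t\not\leq u$ and $t\leq x_k^1+\dots+x_k^i$ for every $k=1,\dots,n$, then there are $j_1,\dots,j_n\in\{1,\dots,i\}$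 with $x_k^{j_k}\not\leq u$ for all $k$ and $x_k^{j_k}Cx_l^{j_l}$ for all $k,l$. A contact join-semilattice (CJS) satisfies (1)–(10) and all $A^1_{m,i}$, $A_{n,i}$. A distributive contact join-semilattice (DCJS) satisfies (1)–(13) and (ad). -}

module Defs where

open import Level using (0ℓ)
open import Data.Nat using (ℕ; zero; suc)
open import Data.Fin using (Fin; zero; suc) renaming (_≤_ to _≤ᶠ_)
open import Data.Product using (Σ; Σ-syntax; ∃; ∃-syntax; _×_; _,_; proj₁)
open import Data.Sum using (_⊎_)
open import Relation.Nullary using (¬_)
open import Relation.Unary using (Pred; _∈_; _⊆_; _≐_; _∩_; _∪_; ∅; U)

-- An abstract structure (B, ≤, 0, 1, +, C).  Equality "=" of the paper is
-- rendered by a relation _≈_ (for the set model: extensional equality of subsets).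
record ContactStructure : Set₂ where
  infix 4 _≈_ _≤_ _C_
  infixr 6 _+_
  field
    Carrier : Set₁
    _≈_     : Carrier → Carrier → Set
    _≤_     : Carrier → Carrier → Set
    𝟘 𝟙     : Carrier
    _+_     : Carrier → Carrier → Carrier
    _C_     : Carrier → Carrier → Set

  bigJoin : ∀ {n} → (Fin (suc n) → Carrier) → Carrier
  bigJoin {zero}  f = f zero
  bigJoin {suc n} f = f zero + bigJoin (λ k → f (suc k))

module _ (S : ContactStructure) where
  open ContactStructure S

  Ax1 Ax2 Ax3 Ax4 Ax5 Ax6 Ax7 Ax8 Ax9 Ax10 Ax11 Ax12 Ax13 AxAd : Set₁
  Ax1  = ∀ x → x ≤ x
  Ax2  = ∀ x y → x ≤ y → y ≤ x → x ≈ y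
  Ax3  = ∀ x y z → x ≤ y → y ≤ z → x ≤ z
  Ax4  = ∀ x y → (x + y) ≈ (y + x)
  Ax5  = ∀ x y → x ≤ x + y
  Ax6  = ∀ x y z → x ≤ z → y ≤ z → x + y ≤ z
  Ax7  = ∀ x → 𝟘 ≤ x
  Ax8  = ∀ x → x ≤ 𝟙
  Ax9  = ∀ x y → x C y → ¬ (x ≈ 𝟘)
  Ax10 = ∀ x y → x C y → y C x
  Ax11 = ∀ x y z → x C (y + z) → (x C y) ⊎ (x C z)
  Ax12 = ∀ x y y′ → x C y → y ≤ y′ → x C y′
  Ax13 = ∀ x → ¬ (x ≈ 𝟘) → x C x
  AxAd = ∀ x a b → x ≤ a + b →
           Σ[ a′ ∈ Carrier ] Σ[ b′ ∈ Carrier ] (a′ ≤ a × b′ ≤ b × x ≈ a′ + b′)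

  -- A¹_{m,i} with m = suc m₀, i = suc i₀  (so m, i ≥ 1)
  A1 : (m₀ i₀ : ℕ) → Set₁
  A1 m₀ i₀ =
    (x y : Carrier) (s t : Fin (suc m₀) → Fin (suc i₀) → Carrier) →
    x C y →
    (∀ j → x ≤ bigJoin (s j)) →
    (∀ j → y ≤ bigJoin (t j)) →
    Σ[ l ∈ (Fin (suc m₀) → Fin (suc i₀)) ] Σ[ k ∈ (Fin (suc m₀) → Fin (suc i₀)) ]
      ((∀ j u → j ≤ᶠ u → s j (l j) C s u (l u)) ×
       (∀ j u → j ≤ᶠ u → t j (k j) C t u (k u)) ×
       (∀ j u → s j (l j) C t u (k u)))

  -- A_{n,i} with n = suc n₀, i = suc i₀  (so n, i ≥ 1)
  A : (n₀ i₀ : ℕ) → Set₁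
  A n₀ i₀ =
    (t u : Carrier) (x : Fin (suc n₀) → Fin (suc i₀) → Carrier) →
    ¬ (t ≤ u) →
    (∀ k → t ≤ bigJoin (x k)) →
    Σ[ j ∈ (Fin (suc n₀) → Fin (suc i₀)) ]
      ((∀ k → ¬ (x k (j k) ≤ u)) ×
       (∀ k l → x k (j k) C x l (j l)))

  record IsCJS : Set₁ where
    field
      ax1 : Ax1
      ax2 : Ax2
      ax3 : Ax3
      ax4 : Ax4
      ax5 : Ax5
      ax6 : Ax6
      ax7 : Ax7
      ax8 : Ax8
      ax9 : Ax9
      ax10 : Ax10
      axA1 : ∀ m₀ i₀ → A1 m₀ i₀
      axA  : ∀ n₀ i₀ → A n₀ i₀

  record IsDCJS : Set₁ where
    field
      ax1 : Ax1
      ax2 : Ax2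
      ax3 : Ax3
      ax4 : Ax4
      ax5 : Ax5
      ax6 : Ax6
      ax7 : Ax7
      ax8 : Ax8
      ax9 : Ax9
      ax10 : Ax10
      ax11 : Ax11
      ax12 : Ax12
      ax13 : Ax13
      axAd : AxAd

-- The set model (B, ⊆, ∅, W, ∪, C) with a C b iff a ∩ b ≠ ∅ (i.e. a ∩ b is inhabited).
-- Subsets of W are predicates W → Set; B is a predicate on subsets.
setModel : (W : Set) (B : Pred (Pred W 0ℓ) 0ℓ) →
           ∅ ∈ B → U ∈ B → (∀ {a b} → a ∈ B → b ∈ B → (a ∪ b) ∈ B) →
           ContactStructure
setModel W B ∅∈B U∈B ∪∈B = record
  { Carrier = Σ (Pred W 0ℓ) (λ a → a ∈ B)
  ; _≈_     = λ a b → proj₁ a ≐ proj₁ b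
  ; _≤_     = λ a b → proj₁ a ⊆ proj₁ b
  ; 𝟘       = ∅ , ∅∈B
  ; 𝟙       = U , U∈B
  ; _+_     = λ a b → (proj₁ a ∪ proj₁ b) , ∪∈B (Data.Product.proj₂ a) (Data.Product.proj₂ b)
  ; _C_     = λ a b → ∃[ w ] (w ∈ (proj₁ a ∩ proj₁ b))
  }

-- In a set model a contact x C y is witnessed by a common point w, and every
-- cover of x (resp. y) by finitely many members has a summand through w; the
-- summands so chosen all contain w, hence pairwise meet.  This gives A¹, and
-- gives A as soon as a non-inclusion t ⊈ u is witnessed by a point of t ∖ u,
-- as it is for decidable subsets of a finite set.
--
-- For the counterexample let B consist of ∅, W and the complements ∁{v} of
-- points.  For distinct p, q, r we have ∁{p} ⊆ ∁{q} ∪ ∁{r}, yet a nonempty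
-- member of B misses at most one point, so the only members lying both in ∁{p}
-- and in ∁{q} (or ∁{r}) are empty: ∁{p} is not a join of such pieces.
module Submission where

open import Defs
open import Level using (0ℓ)
open import Data.Fin using (Fin; zero; suc)
open import Data.Fin.Properties using (¬∀⟶∃¬) renaming (_≟_ to _≟ᶠ_)
open import Data.Nat using (ℕ; suc)
open import Data.Product using (Σ-syntax; ∃-syntax; _×_; _,_; proj₁; proj₂)
open import Data.Sum using (inj₁; inj₂; [_,_])
open import Data.Unit using (tt)
open import Function using (id; const; _∘_)
open import Relation.Binary.Definitions using (DecidableEquality)
open import Relation.Binary.PropositionalEquality using (_≢_; refl; sym; trans)
open import Relation.Nullary using (¬_; yes; no; contradiction)
open import Relation.Nullary.Decidable using (_→-dec_)
open import Relation.Unary using (Pred; Decidable; _∈_; _∉_; _⊆_; _≐_; _∪_; ∁; ｛_｝; ∅; U)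
open import Relation.Unary.Properties using (∅?; U?; ∁?; ∅-⊆; ⊆-U; ⊆-refl; ⊆-trans; ⊆-antisym; ≐-sym; ≐-trans) renaming (map to Decidable-resp-≐)

⊈⇒∃∈∖ : ∀ {n} {t u : Pred (Fin n) 0ℓ} → Decidable t → Decidable u →
         ¬ (t ⊆ u) → ∃[ w ] (w ∈ t × w ∉ u)
⊈⇒∃∈∖ {n} {t} {u} t? u? t⊈u
  with ¬∀⟶∃¬ n (λ w → w ∈ t → w ∈ u) (λ w → t? w →-dec u? w) (λ t⊆u → t⊈u (t⊆u _))
... | w , t↛u with t? w
...   | yes w∈t = w , w∈t , t↛u ∘ const
...   | no  w∉t = contradiction (λ w∈t → contradiction w∈t w∉t) t↛u

module SetModel (W : Set) (B : Pred (Pred W 0ℓ) 0ℓ) (∅∈B : ∅ ∈ B) (U∈B : U ∈ B)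
    (∪∈B : ∀ {a b} → a ∈ B → b ∈ B → (a ∪ b) ∈ B) where

  S : ContactStructure
  S = setModel W B ∅∈B U∈B ∪∈B

  open ContactStructure S

  ∈-bigJoin⁻ : ∀ {n} (f : Fin (suc n) → Carrier) {w} →
               w ∈ proj₁ (bigJoin f) → ∃[ j ] (w ∈ proj₁ (f j))
  ∈-bigJoin⁻ {ℕ.zero} f w∈f      = zero , w∈f
  ∈-bigJoin⁻ {suc n}  f (inj₁ w∈) = zero , w∈
  ∈-bigJoin⁻ {suc n}  f (inj₂ w∈) with ∈-bigJoin⁻ (λ k → f (suc k)) w∈
  ... | j , w∈fj = suc j , w∈fj

  A1-holds : ∀ m₀ i₀ → A1 S m₀ i₀
  A1-holds m₀ i₀ x y s t (w , w∈x , w∈y) x≤s y≤t =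
    l , k ,
    (λ j u _ → w , w∈s j , w∈s u) ,
    (λ j u _ → w , w∈t j , w∈t u) ,
    (λ j u → w , w∈s j , w∈t u)
    where
    l k : Fin (suc m₀) → Fin (suc i₀)
    l j = proj₁ (∈-bigJoin⁻ (s j) (x≤s j w∈x))
    k j = proj₁ (∈-bigJoin⁻ (t j) (y≤t j w∈y))
    w∈s : ∀ j → w ∈ proj₁ (s j (l j))
    w∈s j = proj₂ (∈-bigJoin⁻ (s j) (x≤s j w∈x))
    w∈t : ∀ j → w ∈ proj₁ (t j (k j))
    w∈t j = proj₂ (∈-bigJoin⁻ (t j) (y≤t j w∈y))

  NonInclusionsWitnessed : Set₁
  NonInclusionsWitnessed =
    (t u : Carrier) → ¬ (t ≤ u) → ∃[ w ] (w ∈ proj₁ t × w ∉ proj₁ u)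

  A-holds : NonInclusionsWitnessed → ∀ n₀ i₀ → A S n₀ i₀
  A-holds witness n₀ i₀ t u x t≰u t≤x with witness t u t≰u
  ... | w , w∈t , w∉u = j , (λ k x≤u → w∉u (x≤u (w∈x k))) , (λ k l → w , w∈x k , w∈x l)
    where
    j : Fin (suc n₀) → Fin (suc i₀)
    j k = proj₁ (∈-bigJoin⁻ (x k) (t≤x k w∈t))
    w∈x : ∀ k → w ∈ proj₁ (x k (j k))
    w∈x k = proj₂ (∈-bigJoin⁻ (x k) (t≤x k w∈t))

  isCJS : NonInclusionsWitnessed → IsCJS S
  isCJS witness = record
    { ax1  = λ x → ⊆-refl {x = proj₁ x}
    ; ax2  = λ _ _ → ⊆-antisym
    ; ax3  = λ _ _ _ → ⊆-trans
    ; ax4  = λ x y → ∪-swap {proj₁ x} {proj₁ y} , ∪-swap {proj₁ y} {proj₁ x}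
    ; ax5  = λ _ _ → inj₁
    ; ax6  = λ _ _ _ x≤z y≤z → [ x≤z , y≤z ]
    ; ax7  = λ x → ∅-⊆ (proj₁ x)
    ; ax8  = λ x → ⊆-U (proj₁ x)
    ; ax9  = λ { _ _ (w , w∈x , _) (x⊆∅ , _) → x⊆∅ w∈x }
    ; ax10 = λ { _ _ (w , w∈x , w∈y) → w , w∈y , w∈x }
    ; axA1 = A1-holds
    ; axA  = A-holds witness
    }
    where
    ∪-swap : ∀ {a b : Pred W 0ℓ} → a ∪ b ⊆ b ∪ a
    ∪-swap = [ inj₂ , inj₁ ]

module CoSubsingletons {W : Set} (_≟_ : DecidableEquality W) where

  data Shape : Set where
    empty full : Shape
    all-but    : W → Shape

  ⟦_⟧ : Shape → Pred W 0ℓ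
  ⟦ empty ⟧     = ∅
  ⟦ full ⟧      = U
  ⟦ all-but v ⟧ = ∁ ｛ v ｝

  ⟦_⟧? : ∀ s → Decidable ⟦ s ⟧
  ⟦ empty ⟧?     = ∅?
  ⟦ full ⟧?      = U?
  ⟦ all-but v ⟧? = ∁? (v ≟_)

  _⊔_ : Shape → Shape → Shape
  empty     ⊔ t         = t
  full      ⊔ t         = full
  all-but v ⊔ empty     = all-but v
  all-but v ⊔ full      = full
  all-but v ⊔ all-but w with v ≟ w
  ... | yes _ = all-but v
  ... | no  _ = full

  ⟦⊔⟧ : ∀ s t → ⟦ s ⊔ t ⟧ ≐ ⟦ s ⟧ ∪ ⟦ t ⟧
  ⟦⊔⟧ empty     t         = inj₂ , [ (λ ()) , id ]
  ⟦⊔⟧ full      t         = inj₁ , const tt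
  ⟦⊔⟧ (all-but v) empty   = inj₁ , [ id , (λ ()) ]
  ⟦⊔⟧ (all-but v) full    = inj₂ , const tt
  ⟦⊔⟧ (all-but v) (all-but w) with v ≟ w
  ... | yes refl = inj₁ , [ id , id ]
  ... | no  v≢w  = missed-by-one , const tt
    where
    missed-by-one : U ⊆ ∁ ｛ v ｝ ∪ ∁ ｛ w ｝
    missed-by-one {x} _ with v ≟ x
    ... | yes refl = inj₂ (λ w≡v → v≢w (sym w≡v))
    ... | no  v≢x  = inj₁ v≢x

  ∪-resp-≐ : {a a′ b b′ : Pred W 0ℓ} → a ≐ a′ → b ≐ b′ → a ∪ b ≐ a′ ∪ b′
  ∪-resp-≐ (a⊆ , ⊆a) (b⊆ , ⊆b) =
    [ inj₁ ∘ a⊆ , inj₂ ∘ b⊆ ] , [ inj₁ ∘ ⊆a , inj₂ ∘ ⊆b ]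

  CoSubsingletonOr∅ : Pred (Pred W 0ℓ) 0ℓ
  CoSubsingletonOr∅ a = ∃[ s ] (a ≐ ⟦ s ⟧)

  ∅∈ : ∅ ∈ CoSubsingletonOr∅
  ∅∈ = empty , id , id

  U∈ : U ∈ CoSubsingletonOr∅
  U∈ = full , id , id

  ∪∈ : ∀ {a b} → a ∈ CoSubsingletonOr∅ → b ∈ CoSubsingletonOr∅ → (a ∪ b) ∈ CoSubsingletonOr∅
  ∪∈ (s , a≐s) (t , b≐t) = s ⊔ t , ≐-trans (∪-resp-≐ a≐s b≐t) (≐-sym (⟦⊔⟧ s t))

  ∈⇒Decidable : ∀ {a} → a ∈ CoSubsingletonOr∅ → Decidable a
  ∈⇒Decidable (s , a≐s) = Decidable-resp-≐ (≐-sym a≐s) ⟦ s ⟧?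

  ⊆∁₂⇒empty : ∀ {a p q} → a ∈ CoSubsingletonOr∅ → p ≢ q →
              a ⊆ ∁ ｛ p ｝ → a ⊆ ∁ ｛ q ｝ → a ⊆ ∅
  ⊆∁₂⇒empty (empty , a⊆ , _) _ _ _ x∈a = a⊆ x∈a
  ⊆∁₂⇒empty (full , _ , ⊆a) _ a⊆∁p _ _ = a⊆∁p (⊆a tt) refl
  ⊆∁₂⇒empty (all-but v , _ , ⊆a) p≢q a⊆∁p a⊆∁q _ =
    a⊆∁p (⊆a λ v≡p → a⊆∁q (⊆a λ v≡q → p≢q (trans (sym v≡p) v≡q)) refl) refl

  open SetModel W CoSubsingletonOr∅ ∅∈ U∈ ∪∈ using (S)
  open ContactStructure S using (Carrier)

  ∁｛_｝ : W → Carrier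
  ∁｛ v ｝ = ∁ ｛ v ｝ , all-but v , id , id

  ¬isDCJS : ∀ {p q r} → p ≢ q → p ≢ r → q ≢ r → ¬ IsDCJS S
  ¬isDCJS {p} {q} {r} p≢q p≢r q≢r dcjs
    with IsDCJS.axAd dcjs ∁｛ p ｝ ∁｛ q ｝ ∁｛ r ｝ (proj₁ (⟦⊔⟧ (all-but q) (all-but r)) ∘ ∁p⊆∁q⊔∁r)
    where
    ∁p⊆∁q⊔∁r : ∁ ｛ p ｝ ⊆ ⟦ all-but q ⊔ all-but r ⟧
    ∁p⊆∁q⊔∁r {x} _ with q ≟ r
    ... | yes q≡r = contradiction q≡r q≢r
    ... | no  _   = tt
  ... | (a′ , a′∈) , (b′ , b′∈) , a′⊆∁q , b′⊆∁r , ∁p⊆ , ⊆∁p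
    with ∁p⊆ {q} p≢q
  ... | inj₁ q∈a′ = ⊆∁₂⇒empty a′∈ p≢q (⊆∁p ∘ inj₁) a′⊆∁q q∈a′
  ... | inj₂ q∈b′ = ⊆∁₂⇒empty b′∈ p≢r (⊆∁p ∘ inj₂) b′⊆∁r q∈b′

mainTheorem9 : Σ[ W ∈ Set ] (W × Σ[ B ∈ Pred (Pred W 0ℓ) 0ℓ ]
                 Σ[ ∅∈B ∈ ∅ ∈ B ] Σ[ U∈B ∈ U ∈ B ]
                 Σ[ ∪∈B ∈ (∀ {a b} → a ∈ B → b ∈ B → (a ∪ b) ∈ B) ]
                 (IsCJS (setModel W B ∅∈B U∈B ∪∈B) × ¬ IsDCJS (setModel W B ∅∈B U∈B ∪∈B)))
mainTheorem9 =
  Fin 3 , zero , CoSubsingletonOr∅ , ∅∈ , U∈ , ∪∈ ,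
  isCJS (λ (t , t∈) (u , u∈) → ⊈⇒∃∈∖ (∈⇒Decidable t∈) (∈⇒Decidable u∈)) ,
  ¬isDCJS {zero} {suc zero} {suc (suc zero)} (λ ()) (λ ()) (λ ())
  where
  open CoSubsingletons {Fin 3} _≟ᶠ_
  open SetModel (Fin 3) CoSubsingletonOr∅ ∅∈ U∈ ∪∈ using (isCJS)
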